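{- Let $m,n\ge0$ and define $q_{m,n}=T_{\rm row}^{F(m)-1}(T_{\rm col}^{F(n)-1}(f_{m,n}))$ if $m,n$ are both even; $T_{\rm row}^{F(m)-1}(T_{\rm col}^{F(n-1)-1}(f_{m,n}))$ if $m$ is even and $n$ odd; $T_{\rm row}^{F(m-1)-1}(T_{\rm col}^{F(n)-1}(f_{m,n}))$ if $m$ is odd and $n$ even; $T_{\rm row}^{F(m-1)-1}(T_{\rm col}^{F(n-1)-1}(f_{m,n}))$ if $m,n$ are both odd. Then for each $k$ with $1\le k<F(m)$ and each $l$ with $1\le l<F(n)$, the $(k+1)(l+1)$ prefixes of size $(k,l)$ of the arrays $T_{\rm row}^{ -i}(T_{\rm col}^{ -j}(q_{m,n}))$, $0\le i\le k$, $0\le j\le l$, are the $(k+1)(l+1)$ distinct factors of $f_{\infty,\infty}$ of size $(k,l)$.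
   Context: Fibonacci numbers: $F(0)=F(1)=1$, $F(n)=F(n-1)+F(n-2)$. $2D$ Fibonacci words $f_{m,n}$ over $\{a,b,c,d\}$: $f_{0,0}=a,f_{0,1}=b,f_{1,0}=c,f_{1,1}=d$, and for $k\ge0$, $m,n\ge1$: $f_{k,n+1}=f_{k,n}\obar f_{k,n-1}$ (column concatenation: side by side) and $f_{m+1,k}=f_{m,k}\ominus f_{m-1,k}$ (row concatenation: first on top of second); $f_{m,n}$ has $F(m)$ rows and $F(n)$ columns. For an array $w$ with rows $r_1,\dots,r_p$ and columns $c_1,\dots,c_q$: $T_{\rm col}(w)$ has columns $c_2,\dots,c_q,c_1$; $T_{\rm col}^{ -1}(w)$ has columns $c_q,c_1,\dots,c_{q-1}$; $T_{\rm row}(w)$ has rows $r_2,\dots,r_p,r_1$; $T_{\rm row}^{ -1}(w)$ has rows $r_p,r_1,\dots,r_{p-1}$; powers are iterates, exponent $0$ is the identity. The prefix of size $(k,l)$ of an array is its top-left block of $k$ rows and $l$ columns. $f_{\infty,\infty}=[f(i,j)]_{i,j\ge1}$ is the fixed point $\lim_{n}\mu^n(d)$ of the $2D$ morphism $d\mapsto\begin{smallmatrix}d&c\\ b&a\end{smallmatrix}$, $c\mapsto\begin{smallmatrix}d\\ b\end{smallmatrix}$, $b\mapsto\begin{smallmatrix}d&c\end{smallmatrix}$, $a\mapsto d$; equivalently, with $x=101101011\cdots$ the fixed point of $1\mapsto10,0\mapsto1$, $f(i,j)=d,c,b,a$ according as $(x_i,x_j)=(1,1),(1,0),(0,1),(0,0)$.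 A factor of size $(k,l)$ is a $k\times l$ block of $f_{\infty,\infty}$ in rows $i+1,\dots,i+k$, columns $j+1,\dots,j+l$ for some $i,j\ge0$. -}

module Defs where

open import Data.Nat using (ℕ; zero; suc; _+_; _∸_; _≤_; _<_)
open import Data.Nat.Properties using (<⇒≤)
open import Data.Nat.DivMod using (_mod_)
open import Data.Fin using (Fin; toℕ; splitAt; inject≤)
open import Data.Sum using (inj₁; inj₂)
open import Data.Bool using (Bool; true; false; if_then_else_)
open import Data.List using (List; []; _∷_; concatMap)
open import Data.Product using (∃; ∃-syntax)
open import Relation.Binary.PropositionalEquality using (_≡_)

F : ℕ → ℕ
F zero = 1
F (suc zero) = 1
F (suc (suc n)) = F (suc n) + F n

data Letter : Set where
  a b c d : Letter

Array : ℕ → ℕ → Set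
Array k l = Fin k → Fin l → Letter

_≈A_ : ∀ {k l} → Array k l → Array k l → Set
u ≈A v = ∀ i j → u i j ≡ v i j

_⦶_ : ∀ {r p q} → Array r p → Array r q → Array r (p + q)
_⦶_ {p = p} u v i j with splitAt p j
... | inj₁ j' = u i j'
... | inj₂ j' = v i j'

_⊖_ : ∀ {p q s} → Array p s → Array q s → Array (p + q) s
_⊖_ {p = p} u v i j with splitAt p i
... | inj₁ i' = u i' j
... | inj₂ i' = v i' j

fw : (m n : ℕ) → Array (F m) (F n)
fw zero zero = λ _ _ → a
fw zero (suc zero) = λ _ _ → b
fw (suc zero) zero = λ _ _ → c
fw (suc zero) (suc zero) = λ _ _ → d
fw m (suc (suc n)) = fw m (suc n) ⦶ fw m n
fw (suc (suc m)) zero = fw (suc m) zero ⊖ fw m zero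
fw (suc (suc m)) (suc zero) = fw (suc m) (suc zero) ⊖ fw m (suc zero)

next : ∀ {q} → Fin q → Fin q
next {suc q} j = suc (toℕ j) mod suc q

prev : ∀ {q} → Fin q → Fin q
prev {suc q} j = (toℕ j + q) mod suc q

-- T_col: columns c2..cq,c1 ; T_col⁻¹: columns cq,c1..c(q-1); same for rows
Tcol : ∀ {p q} → Array p q → Array p q
Tcol w i j = w i (next j)

Tcol⁻¹ : ∀ {p q} → Array p q → Array p q
Tcol⁻¹ w i j = w i (prev j)

Trow : ∀ {p q} → Array p q → Array p q
Trow w i j = w (next i) j

Trow⁻¹ : ∀ {p q} → Array p q → Array p q
Trow⁻¹ w i j = w (prev i) j

iter : ∀ {A : Set} → ℕ → (A → A) → A → A
iter zero g x = x
iter (suc n) g x = g (iter n g x)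

isEven : ℕ → Bool
isEven zero = true
isEven (suc n) = if isEven n then false else true

expo : ℕ → ℕ
expo m = if isEven m then F m ∸ 1 else F (m ∸ 1) ∸ 1

q : (m n : ℕ) → Array (F m) (F n)
q m n = iter (expo m) Trow (iter (expo n) Tcol (fw m n))

prefix : ∀ {r s} (k l : ℕ) → k ≤ r → l ≤ s → Array r s → Array k l
prefix k l k≤r l≤s w i j = w (inject≤ i k≤r) (inject≤ j l≤s)

P : (m n k l : ℕ) → k < F m → l < F n → ℕ → ℕ → Array k l
P m n k l k< l< i j = prefix k l (<⇒≤ k<) (<⇒≤ l<) (iter i Trow⁻¹ (iter j Tcol⁻¹ (q m n)))

-- Fibonacci infinite word x = 101101011... fixed point of 1 ↦ 10, 0 ↦ 1
φ : Bool → List Bool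
φ true = true ∷ false ∷ []
φ false = true ∷ []

φⁿ : ℕ → List Bool
φⁿ zero = true ∷ []
φⁿ (suc n) = concatMap φ (φⁿ n)

nth : List Bool → ℕ → Bool
nth [] _ = false
nth (x ∷ xs) zero = x
nth (x ∷ xs) (suc i) = nth xs i

-- x_i for i ≥ 1 (φⁿ i has length F(i+1) > i-1, so the default is never used)
x : ℕ → Bool
x i = nth (φⁿ i) (i ∸ 1)

letter : Bool → Bool → Letter
letter true true = d
letter true false = c
letter false true = b
letter false false = a

fInf : ℕ → ℕ → Letter
fInf i j = letter (x i) (x j)

IsFactor : ∀ {k l} → Array k l → Set
IsFactor {k} {l} u = ∃[ i ] ∃[ j ] (∀ r s → u r s ≡ fInf (suc (i + toℕ r)) (suc (j + toℕ s)))

module Submission where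

-- Both f_{m,n} and f_{∞,∞} are products of one-dimensional words: the letter at (i, j) is
-- letter (s i) (s j) for the finite Fibonacci words s = s_m, s_n, resp. for the infinite word x.
-- Row and column shifts act independently, so the theorem splits into two copies of a statement
-- about words. The finite word s_L is a conjugate of one period of the rotation word of slope
-- F (L ∸ 1)/F L, and the exponent in q_{m,n} is chosen so that the k + 1 prefixes of the shifted
-- arrays are the factors of that rotation word starting at F L + 1 ∸ i, 0 ≤ i ≤ k. For a rotation
-- word of slope p/N with p, N coprime, a factor of length k < N is determined by the position at
-- which the orbit n·p mod N is smallest; hence these k + 1 windows are distinct and every factor
-- is one of them. Consecutive Fibonacci slopes are Farey neighbours (Cassini's identity), so the
-- rotation words of all levels agree on long prefixes, all of which are prefixes of x.

open import Defs hiding (a; b; c; d)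
open import Data.Nat
open import Data.Nat.Properties
open import Data.Nat.DivMod
open import Data.Nat.Divisibility using (_∣_; ∣⇒≤; m%n≡0⇒n∣m; ∣-trans; ∣1⇒≡1; ∣m+n∣m⇒∣n; m∣m*n; n∣m*n)
open import Data.Nat.Coprimality using (Coprime; coprime-divisor)
open import Data.Nat.Tactic.RingSolver using (solve-∀)
open import Data.Bool using (Bool; true; false)
open import Data.List using (List; []; _∷_; _++_; length; concatMap)
open import Data.List.Properties using (length-++; concatMap-++)
open import Data.Fin using (Fin; toℕ; splitAt; inject≤; fromℕ<)
open import Data.Fin.Properties
  using (toℕ-↑ˡ; toℕ-↑ʳ; splitAt⁻¹-↑ˡ; splitAt⁻¹-↑ʳ; toℕ<n; toℕ-fromℕ<; toℕ-inject≤)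
open import Data.Product using (Σ; _×_; _,_; proj₁; proj₂; ∃-syntax)
open import Data.Sum using (inj₁; inj₂; [_,_]′)
open import Data.Empty using (⊥-elim)
open import Relation.Nullary using (yes; no)
open import Relation.Nullary.Decidable using (dec-true; dec-false)
open import Relation.Binary.Definitions using (Tri; tri<; tri≈; tri>)
open import Relation.Binary.PropositionalEquality

%-/-unique : ∀ m r k n .{{_ : NonZero n}} → m ≡ r + k * n → r < n → m % n ≡ r × m / n ≡ k
%-/-unique m r k n m≡ r<n = m%n≡r , m/n≡k
  where
  m%n≡r : m % n ≡ r
  m%n≡r = trans (cong (_% n) m≡) (trans ([m+kn]%n≡m%n r k n) (m<n⇒m%n≡m r<n))
  m/n≡k : m / n ≡ k
  m/n≡k = *-cancelʳ-≡ (m / n) k n (+-cancelˡ-≡ r _ _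
    (trans (trans (cong (_+ m / n * n) (sym m%n≡r)) (sym (m≡m%n+[m/n]*n m n))) m≡))

/-unique : ∀ m k n .{{_ : NonZero n}} → k * n ≤ m → m < suc k * n → m / n ≡ k
/-unique m k n lo hi = proj₂ (%-/-unique m (m ∸ k * n) k n (sym (m∸n+n≡m lo)) r<n)
  where
  r<n : m ∸ k * n < n
  r<n = m<n+o⇒m∸n<o m (k * n) (subst (m <_) (+-comm n (k * n)) hi)

-- n·p′/N′ exceeds n·p/N by n/(N·N′) < 1/N, too little to pass an integer.
det1⇒[n*p]/N≡[n*p′]/N′ : ∀ p N p′ N′ .{{_ : NonZero N}} .{{_ : NonZero N′}} →
  p′ * N ≡ p * N′ + 1 → ∀ n → n < N′ → (n * p) / N ≡ (n * p′) / N′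
det1⇒[n*p]/N≡[n*p′]/N′ p N p′ N′ det n n<N′ = sym (/-unique (n * p′) k N′ lo hi)
  where
  k = (n * p) / N
  r = (n * p) % N
  np′N≡ : n * p′ * N ≡ k * N′ * N + (r * N′ + n)
  np′N≡ = begin
    n * p′ * N            ≡⟨ *-assoc n p′ N ⟩
    n * (p′ * N)          ≡⟨ cong (n *_) det ⟩
    n * (p * N′ + 1)      ≡⟨ expand n p N′ ⟩
    n * p * N′ + n        ≡⟨ cong (λ v → v * N′ + n) (m≡m%n+[m/n]*n (n * p) N) ⟩
    (r + k * N) * N′ + n  ≡⟨ regroup r k N N′ n ⟩
    k * N′ * N + (r * N′ + n) ∎
    where
    open ≡-Reasoning
    expand : ∀ n p N′ → n * (p * N′ + 1) ≡ n * p * N′ + n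
    expand = solve-∀
    regroup : ∀ r k N N′ n → (r + k * N) * N′ + n ≡ k * N′ * N + (r * N′ + n)
    regroup = solve-∀
  lo : k * N′ ≤ n * p′
  lo = *-cancelʳ-≤ (k * N′) (n * p′) N (subst (k * N′ * N ≤_) (sym np′N≡) (m≤m+n _ _))
  small : r * N′ + n < N * N′
  small = begin-strict
    r * N′ + n   <⟨ +-monoʳ-< (r * N′) n<N′ ⟩
    r * N′ + N′  ≡⟨ +-comm (r * N′) N′ ⟩
    suc r * N′   ≤⟨ *-monoˡ-≤ N′ (m%n<n (n * p) N) ⟩
    N * N′       ∎
    where open ≤-Reasoning
  hi : n * p′ < suc k * N′
  hi = *-cancelʳ-< N (n * p′) (suc k * N′) (begin-strict
    n * p′ * N                 ≡⟨ np′N≡ ⟩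
    k * N′ * N + (r * N′ + n)  <⟨ +-monoʳ-< (k * N′ * N) small ⟩
    k * N′ * N + N * N′        ≡⟨ collect k N′ N ⟩
    suc k * N′ * N             ∎)
    where
    open ≤-Reasoning
    collect : ∀ k N′ N → k * N′ * N + N * N′ ≡ suc k * N′ * N
    collect = solve-∀

m%n≡0⇒m≡n : ∀ {m n} .{{_ : NonZero n}} → 0 < m → m < n + n → m % n ≡ 0 → m ≡ n
m%n≡0⇒m≡n {m} {n} 0<m m<2n m%n≡0 with m <? n
... | yes m<n = ⊥-elim (<⇒≢ 0<m (sym (trans (sym (m<n⇒m%n≡m m<n)) m%n≡0)))
... | no m≮n = trans (sym (m∸n+n≡m n≤m)) (cong (_+ n) m∸n≡0)
  where
  n≤m = ≮⇒≥ m≮n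
  m∸n≡0 : m ∸ n ≡ 0
  m∸n≡0 = trans (sym (m<n⇒m%n≡m (m<n+o⇒m∸n<o m n m<2n)))
                (trans (m≤n⇒[n∸m]%m≡n%m n≤m) m%n≡0)

n≤m<n+n⇒m%n≡m∸n : ∀ {m n} .{{_ : NonZero n}} → n ≤ m → m < n + n → m % n ≡ m ∸ n
n≤m<n+n⇒m%n≡m∸n {m} {n} n≤m m<2n =
  trans (sym (m≤n⇒[n∸m]%m≡n%m n≤m)) (m<n⇒m%n≡m (m<n+o⇒m∸n<o m n m<2n))

<ᵇ-∸-cancel : ∀ o m n → o ≤ m → o ≤ n → (m ∸ o <ᵇ n ∸ o) ≡ (m <ᵇ n)
<ᵇ-∸-cancel o m n o≤m o≤n with m <? n
... | yes m<n = trans (dec-true (_ <? _) (∸-monoˡ-< m<n o≤m)) (sym (dec-true (_ <? _) m<n))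
... | no m≮n = trans (dec-false (_ <? _) (≤⇒≯ (∸-monoˡ-≤ o (≮⇒≥ m≮n))))
                     (sym (dec-false (_ <? _) m≮n))

argmin : (f : ℕ → ℕ) (k : ℕ) → Σ ℕ λ j → j ≤ k × (∀ i → i ≤ k → f j ≤ f i)
argmin f zero = 0 , z≤n , λ { .0 z≤n → ≤-refl }
argmin f (suc k) with argmin f k
... | j , j≤k , min with f j ≤? f (suc k)
...   | yes fj≤ = j , m≤n⇒m≤1+n j≤k , λ i i≤1+k →
  [ (λ i<1+k → min i (s≤s⁻¹ i<1+k)) , (λ { refl → fj≤ }) ]′ (m≤n⇒m<n∨m≡n i≤1+k)
...   | no fj≰ = suc k , ≤-refl , λ i i≤1+k →
  [ (λ i<1+k → ≤-trans (<⇒≤ (≰⇒> fj≰)) (min i (s≤s⁻¹ i<1+k))) , (λ { refl → ≤-refl }) ]′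
    (m≤n⇒m<n∨m≡n i≤1+k)

+-gap-step : ∀ {x x′ y y′ u v} c {s} → x′ + c ≡ x + s → y′ + c ≡ y + s → x + u ≡ y + v → x′ + u ≡ y′ + v
+-gap-step {x} {x′} {y} {y′} {u} {v} c {s} x≡ y≡ gap = +-cancelʳ-≡ c (x′ + u) (y′ + v) (begin
  x′ + u + c  ≡⟨ swap x′ u c ⟩
  x′ + c + u  ≡⟨ cong (_+ u) x≡ ⟩
  x + s + u   ≡⟨ swap x s u ⟩
  x + u + s   ≡⟨ cong (_+ s) gap ⟩
  y + v + s   ≡⟨ swap y v s ⟩
  y + s + v   ≡⟨ cong (_+ v) y≡ ⟨
  y′ + c + v  ≡⟨ swap y′ c v ⟩
  y′ + v + c  ∎)
  where
  open ≡-Reasoning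
  swap : ∀ m n o → m + n + o ≡ m + o + n
  swap = solve-∀

false≢true : false ≢ true
false≢true ()

suc[n∸i+r]≡n∸[i∸suc[r]] : ∀ n i r → r < i → i ≤ n → suc (n ∸ i + r) ≡ n ∸ (i ∸ suc r)
suc[n∸i+r]≡n∸[i∸suc[r]] n i r r<i i≤n = begin
  suc (n ∸ i + r)                  ≡⟨ +-suc (n ∸ i) r ⟨
  n ∸ i + suc r                    ≡⟨ cong (λ v → n ∸ v + suc r) (m∸n+n≡m r<i) ⟨
  n ∸ (i ∸ suc r + suc r) + suc r  ≡⟨ cong (_+ suc r) (∸-+-assoc n (i ∸ suc r) (suc r)) ⟨
  n ∸ (i ∸ suc r) ∸ suc r + suc r  ≡⟨ m∸n+n≡m 1+r≤ ⟩
  n ∸ (i ∸ suc r)                  ∎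
  where
  open ≡-Reasoning
  1+r≤ : suc r ≤ n ∸ (i ∸ suc r)
  1+r≤ = subst (_≤ n ∸ (i ∸ suc r)) (m+n∸n≡m (suc r) (i ∸ suc r))
           (∸-monoˡ-≤ (i ∸ suc r) (subst (_≤ n) (trans (sym (m∸n+n≡m r<i)) (+-comm (i ∸ suc r) (suc r))) i≤n))

suc[n∸i+r]≡suc[r∸i]+n : ∀ n i r → i ≤ r → i ≤ n → suc (n ∸ i + r) ≡ suc (r ∸ i) + n
suc[n∸i+r]≡suc[r∸i]+n n i r i≤r i≤n = cong suc (begin
  n ∸ i + r            ≡⟨ cong (n ∸ i +_) (m∸n+n≡m i≤r) ⟨
  n ∸ i + (r ∸ i + i)  ≡⟨ swap (n ∸ i) (r ∸ i) i ⟩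
  r ∸ i + (n ∸ i + i)  ≡⟨ cong (r ∸ i +_) (m∸n+n≡m i≤n) ⟩
  r ∸ i + n            ∎)
  where
  open ≡-Reasoning
  swap : ∀ x y z → x + (y + z) ≡ y + (x + z)
  swap = solve-∀

suc[m∸suc[n]]≡m∸n : ∀ m n → n < m → suc (m ∸ suc n) ≡ m ∸ n
suc[m∸suc[n]]≡m∸n (suc m) zero _ = refl
suc[m∸suc[n]]≡m∸n (suc m) (suc n) (s≤s n<m) = suc[m∸suc[n]]≡m∸n m n n<m

[m%n+k]%n≡[m+k]%n : ∀ m k n .{{_ : NonZero n}} → (m % n + k) % n ≡ (m + k) % n
[m%n+k]%n≡[m+k]%n m k n = trans (%-distribˡ-+ (m % n) k n)
  (trans (cong (λ v → (v + k % n) % n) (m%n%n≡m%n m n)) (sym (%-distribˡ-+ m k n)))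

r+i*[N∸1]+suc[N]≡suc[N∸i+r]+i*N : ∀ N r i → i ≤ N → r + i * (N ∸ 1) + suc N ≡ suc (N ∸ i + r) + i * N
r+i*[N∸1]+suc[N]≡suc[N∸i+r]+i*N zero r .zero z≤n = +-comm (r + 0) 1
r+i*[N∸1]+suc[N]≡suc[N∸i+r]+i*N (suc N) r i i≤N = begin
  r + i * N + suc (suc N)              ≡⟨ cong (λ v → r + i * N + suc v) (m∸n+n≡m i≤N) ⟨
  r + i * N + suc (suc N ∸ i + i)      ≡⟨ regroup r i N (suc N ∸ i) ⟩
  suc (suc N ∸ i + r) + i * suc N      ∎
  where
  open ≡-Reasoning
  regroup : ∀ r i N d → r + i * N + (1 + (d + i)) ≡ (1 + (d + r)) + i * (1 + N)
  regroup = solve-∀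

-- The rotation (mechanical) word of slope p/N: for n ≥ 1, mech n holds exactly when
-- ⌊n·p/N⌋ > ⌊(n ∸ 1)·p/N⌋; mech 0 holds as well, so mech is N-periodic from 0 on.
module Rotation (p N : ℕ) .{{_ : NonZero N}} where

  orbit : ℕ → ℕ
  orbit n = (n * p) % N

  winding : ℕ → ℕ
  winding n = (n * p) / N

  mech : ℕ → Bool
  mech n = orbit n <ᵇ p

  window : ℕ → ℕ → Bool
  window i r = mech (suc (N ∸ i + r))

  data Advance (n : ℕ) : Set where
    inside : orbit n + p < N → orbit (suc n) ≡ orbit n + p →
             winding (suc n) ≡ winding n → mech (suc n) ≡ false → Advance n
    wraps  : N ≤ orbit n + p → orbit (suc n) + N ≡ orbit n + p →
             winding (suc n) ≡ suc (winding n) → mech (suc n) ≡ true → Advance n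

  module Laws (1≤p : 1 ≤ p) (p<N : p < N) where

    instance
      p-nonZero : NonZero p
      p-nonZero = >-nonZero 1≤p

    orbit<N : ∀ n → orbit n < N
    orbit<N n = m%n<n (n * p) N

    step≡ : ∀ n → suc n * p ≡ (orbit n + p) + winding n * N
    step≡ n = trans (cong (p +_) (m≡m%n+[m/n]*n (n * p) N)) (shuffle p (orbit n) (winding n * N))
      where
      shuffle : ∀ p r q → p + (r + q) ≡ (r + p) + q
      shuffle = solve-∀

    advance : ∀ n → Advance n
    advance n with orbit n + p <? N
    ... | yes lt = inside lt (proj₁ divmod) (proj₂ divmod)
                     (trans (cong (_<ᵇ p) (proj₁ divmod)) (dec-false (_ <? _) (≤⇒≯ (m≤n+m p (orbit n)))))
      where divmod = %-/-unique (suc n * p) (orbit n + p) (winding n) N (step≡ n) lt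
    ... | no ge = wraps N≤ orbit≡ (proj₂ divmod) (trans (cong (_<ᵇ p) (proj₁ divmod)) (dec-true (_ <? _) r<p))
      where
      N≤ = ≮⇒≥ ge
      r = orbit n + p ∸ N
      r<p : r < p
      r<p = m<n+o⇒m∸n<o (orbit n + p) N (+-monoˡ-< p (orbit<N n))
      divmod = %-/-unique (suc n * p) r (suc (winding n)) N
        (trans (step≡ n) (trans (cong (_+ winding n * N) (sym (m∸n+n≡m N≤))) (+-assoc r N _)))
        (<-trans r<p p<N)
      orbit≡ : orbit (suc n) + N ≡ orbit n + p
      orbit≡ = trans (cong (_+ N) (proj₁ divmod)) (m∸n+n≡m N≤)

    mech-0 : mech 0 ≡ true
    mech-0 = dec-true (_ <? _) (subst (_< p) (sym (m<n⇒m%n≡m (<-trans 1≤p p<N))) 1≤p)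

    orbit-N : orbit N ≡ 0
    orbit-N = trans (cong (_% N) (*-comm N p)) (m*n%n≡0 p N)

    mech-N : mech N ≡ true
    mech-N = dec-true (_ <? _) (subst (_< p) (sym orbit-N) 1≤p)

    mech-1 : mech 1 ≡ false
    mech-1 = dec-false (_ <? _) (≤⇒≯ (≤-reflexive (sym (trans (cong (_% N) (+-identityʳ p)) (m<n⇒m%n≡m p<N)))))

    mech-periodic : ∀ n k → mech (n + k * N) ≡ mech n
    mech-periodic n k = cong (_<ᵇ p) (trans (cong (_% N) (distrib n k N p)) ([m+kn]%n≡m%n (n * p) (k * p) N))
      where
      distrib : ∀ n k N p → (n + k * N) * p ≡ n * p + k * p * N
      distrib = solve-∀

    mech-+N : ∀ n → mech (n + N) ≡ mech n
    mech-+N n = trans (cong (λ v → mech (n + v)) (sym (+-identityʳ N))) (mech-periodic n 1)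

    mech-% : ∀ m n → mech (m % N + n) ≡ mech (m + n)
    mech-% m n = trans (sym (mech-periodic (m % N + n) (m / N)))
                       (cong mech (trans (swap (m % N) n (m / N * N)) (cong (_+ n) (sym (m≡m%n+[m/n]*n m N)))))
      where
      swap : ∀ m n o → m + n + o ≡ m + o + n
      swap = solve-∀

    mech-descent : ∀ n → mech (suc n) ≡ (orbit (suc n) <ᵇ orbit n)
    mech-descent n with advance n
    ... | inside _ orbit≡ _ mech≡ =
      trans mech≡ (sym (dec-false (_ <? _) (≤⇒≯ (subst (orbit n ≤_) (sym orbit≡) (m≤m+n (orbit n) p)))))
    ... | wraps _ orbit≡ _ mech≡ = trans mech≡ (sym (dec-true (_ <? _) drop))
      where
      drop : orbit (suc n) < orbit n
      drop = +-cancelʳ-< N (orbit (suc n)) (orbit n) (subst (_< orbit n + N) (sym orbit≡) (+-monoʳ-< (orbit n) p<N))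

    mech-descent-+ : ∀ a r → mech (suc (a + r)) ≡ (orbit (a + suc r) <ᵇ orbit (a + r))
    mech-descent-+ a r = trans (mech-descent (a + r)) (cong (λ v → orbit v <ᵇ orbit (a + r)) (sym (+-suc a r)))

    orbit-nonzero : Coprime N p → ∀ n → 0 < n → n < N → orbit n ≢ 0
    orbit-nonzero coprime n 0<n n<N orbit≡0 = <⇒≱ n<N (∣⇒≤ {{>-nonZero 0<n}} N∣n)
      where
      N∣n : N ∣ n
      N∣n = coprime-divisor coprime (subst (N ∣_) (*-comm n p) (m%n≡0⇒n∣m (n * p) N orbit≡0))

    orbit-+ : ∀ m n → (orbit m + orbit n) % N ≡ orbit (m + n)
    orbit-+ m n = trans (sym (%-distribˡ-+ (m * p) (n * p) N)) (cong (_% N) (sym (*-distribʳ-+ p m n)))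

    orbit-+N : ∀ n → orbit (n + N) ≡ orbit n
    orbit-+N n = trans (cong (_% N) (trans (*-distribʳ-+ p n N) (cong (n * p +_) (*-comm N p))))
                       ([m+kn]%n≡m%n (n * p) p N)

    orbit-complement : Coprime N p → ∀ j → 0 < j → j < N → orbit (N ∸ j) + orbit j ≡ N
    orbit-complement coprime j 0<j j<N =
      m%n≡0⇒m≡n (≤-trans (n≢0⇒n>0 (orbit-nonzero coprime j 0<j j<N)) (m≤n+m _ _))
                (+-mono-< (orbit<N (N ∸ j)) (orbit<N j))
                (trans (orbit-+ (N ∸ j) j) (trans (cong orbit (m∸n+n≡m (<⇒≤ j<N))) orbit-N))

    -- orbit (N ∸ j) = N ∸ orbit j, so orbit (N ∸ j) < p exactly when the step from j wraps.
    mech-reflect : Coprime N p → ∀ j → 1 ≤ j → 2 + j ≤ N → mech (N ∸ j) ≡ mech (suc j)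
    mech-reflect coprime j 1≤j 2+j≤N with advance j
    ... | inside below _ _ mech≡ = trans (dec-false (_ <? _) (≤⇒≯ p≤)) (sym mech≡)
      where
      p≤ : p ≤ orbit (N ∸ j)
      p≤ = +-cancelʳ-≤ (orbit j) p _ (<⇒≤ (subst₂ _<_ (+-comm (orbit j) p)
             (sym (orbit-complement coprime j 1≤j (<-trans (n<1+n j) 2+j≤N))) below))
    ... | wraps _ orbit≡ _ mech≡ = trans (dec-true (_ <? _) <p) (sym mech≡)
      where
      N< : N < orbit j + p
      N< = subst (N <_) orbit≡ (subst (_< orbit (suc j) + N) (+-identityˡ N)
             (+-monoˡ-< N (n≢0⇒n>0 (orbit-nonzero coprime (suc j) z<s 2+j≤N))))
      <p : orbit (N ∸ j) < p
      <p = +-cancelˡ-< (orbit j) _ p (subst (_< orbit j + p)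
             (trans (sym (orbit-complement coprime j 1≤j (<-trans (n<1+n j) 2+j≤N))) (+-comm _ (orbit j))) N<)

    orbit-rebase-sum : ∀ a j₀ j → j₀ ≤ N → (orbit (N ∸ j₀ + j) + orbit (a + j₀)) % N ≡ orbit (a + j)
    orbit-rebase-sum a j₀ j j₀≤N = trans (orbit-+ (N ∸ j₀ + j) (a + j₀)) (trans (cong orbit indices) (orbit-+N (a + j)))
      where
      swap : ∀ m j n j₀ → m + j + (n + j₀) ≡ n + j + (m + j₀)
      swap = solve-∀
      indices : N ∸ j₀ + j + (a + j₀) ≡ a + j + N
      indices = trans (swap (N ∸ j₀) j a j₀) (cong (a + j +_) (m∸n+n≡m j₀≤N))

    orbit-rebase : ∀ a j₀ j → j₀ ≤ N → orbit (a + j₀) ≤ orbit (a + j) →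
                   orbit (N ∸ j₀ + j) ≡ orbit (a + j) ∸ orbit (a + j₀)
    orbit-rebase a j₀ j j₀≤N low with orbit (N ∸ j₀ + j) + orbit (a + j₀) <? N
    ... | yes lt = trans (sym (m+n∸n≡m _ (orbit (a + j₀))))
                         (cong (_∸ orbit (a + j₀)) (trans (sym (m<n⇒m%n≡m lt)) (orbit-rebase-sum a j₀ j j₀≤N)))
    ... | no ge = ⊥-elim (<⇒≱ (orbit<N (N ∸ j₀ + j)) (+-cancelʳ-≤ (orbit (a + j₀)) N _ N+d≤))
      where
      N≤ = ≮⇒≥ ge
      sum≡ : orbit (N ∸ j₀ + j) + orbit (a + j₀) ≡ orbit (a + j) + N
      sum≡ = trans (sym (m∸n+n≡m N≤)) (cong (_+ N) (trans
        (sym (n≤m<n+n⇒m%n≡m∸n N≤ (+-mono-< (orbit<N (N ∸ j₀ + j)) (orbit<N (a + j₀)))))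
        (orbit-rebase-sum a j₀ j j₀≤N)))
      N+d≤ : N + orbit (a + j₀) ≤ orbit (N ∸ j₀ + j) + orbit (a + j₀)
      N+d≤ = subst (N + orbit (a + j₀) ≤_) (sym sum≡) (subst (_≤ orbit (a + j) + N) (+-comm _ N) (+-monoˡ-≤ N low))

    -- Letters are descents of the orbit; rebasing the orbit at its minimum over a, …, a + k
    -- keeps every comparison, and turns the factor at a + 1 into a window.
    window-complete : ∀ a k → k < N → Σ ℕ λ i → i ≤ k × (∀ r → r < k → mech (suc (a + r)) ≡ window i r)
    window-complete a k k<N with argmin (λ j → orbit (a + j)) k
    ... | j₀ , j₀≤k , min = j₀ , j₀≤k , same
      where
      j₀≤N = <⇒≤ (≤-<-trans j₀≤k k<N)
      same : ∀ r → r < k → mech (suc (a + r)) ≡ window j₀ r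
      same r r<k = begin
        mech (suc (a + r))
          ≡⟨ mech-descent-+ a r ⟩
        (orbit (a + suc r) <ᵇ orbit (a + r))
          ≡⟨ <ᵇ-∸-cancel (orbit (a + j₀)) _ _ (min (suc r) r<k) (min r (<⇒≤ r<k)) ⟨
        (orbit (a + suc r) ∸ orbit (a + j₀) <ᵇ orbit (a + r) ∸ orbit (a + j₀))
          ≡⟨ cong₂ _<ᵇ_ (orbit-rebase a j₀ (suc r) j₀≤N (min (suc r) r<k))
                         (orbit-rebase a j₀ r j₀≤N (min r (<⇒≤ r<k))) ⟨
        (orbit (N ∸ j₀ + suc r) <ᵇ orbit (N ∸ j₀ + r))
          ≡⟨ mech-descent-+ (N ∸ j₀) r ⟨
        window j₀ r ∎
        where open ≡-Reasoning

    -- Equal letters mean both orbits wrap or both do not, so their gap is preserved.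
    orbit-gap-invariant : ∀ a a′ j → (∀ r → r < j → mech (suc (a + r)) ≡ mech (suc (a′ + r))) →
                          orbit (a + j) + orbit a′ ≡ orbit (a′ + j) + orbit a
    orbit-gap-invariant a a′ zero _ =
      trans (cong (λ v → orbit v + orbit a′) (+-identityʳ a))
            (trans (+-comm (orbit a) (orbit a′)) (cong (λ v → orbit v + orbit a) (sym (+-identityʳ a′))))
    orbit-gap-invariant a a′ (suc j) same =
      subst₂ (λ u v → orbit u + orbit a′ ≡ orbit v + orbit a) (sym (+-suc a j)) (sym (+-suc a′ j)) step
      where
      gap = orbit-gap-invariant a a′ j (λ r r<j → same r (m<n⇒m<1+n r<j))
      step : orbit (suc (a + j)) + orbit a′ ≡ orbit (suc (a′ + j)) + orbit a
      step with advance (a + j) | advance (a′ + j) | same j ≤-refl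
      ... | inside _ e _ _ | inside _ e′ _ _ | _ = +-gap-step 0 (trans (+-identityʳ _) e) (trans (+-identityʳ _) e′) gap
      ... | wraps _ e _ _  | wraps _ e′ _ _  | _ = +-gap-step N e e′ gap
      ... | inside _ _ _ m | wraps _ _ _ m′  | m≡ = ⊥-elim (false≢true (trans (sym m) (trans m≡ m′)))
      ... | wraps _ _ _ m  | inside _ _ _ m′ | m≡ = ⊥-elim (false≢true (trans (sym m′) (trans (sym m≡) m)))

    -- Two agreeing windows i < i′ would force orbit (N ∸ i′ + i) = 0, excluded by coprimality.
    window-injective : Coprime N p → ∀ k i i′ → i ≤ k → i′ ≤ k → k < N →
                       (∀ r → r < k → window i r ≡ window i′ r) → i ≡ i′
    window-injective coprime k i i′ i≤k i′≤k k<N same = by-cases (<-cmp i i′)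
      where
      i<N = ≤-<-trans i≤k k<N
      i′<N = ≤-<-trans i′≤k k<N
      orbit≡0 : ∀ j → j ≤ N → orbit (N ∸ j + j) ≡ 0
      orbit≡0 j j≤N = trans (cong orbit (m∸n+n≡m j≤N)) orbit-N
      gap : ∀ j → j ≤ k → orbit (N ∸ i + j) + orbit (N ∸ i′) ≡ orbit (N ∸ i′ + j) + orbit (N ∸ i)
      gap j j≤k = orbit-gap-invariant (N ∸ i) (N ∸ i′) j (λ r r<j → same r (<-≤-trans r<j j≤k))
      sum≡ : orbit (N ∸ i + i′) + orbit (N ∸ i′ + i) + orbit (N ∸ i) ≡ 0 + orbit (N ∸ i)
      sum≡ = begin
        orbit (N ∸ i + i′) + orbit (N ∸ i′ + i) + orbit (N ∸ i)
          ≡⟨ +-assoc (orbit (N ∸ i + i′)) _ _ ⟩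
        orbit (N ∸ i + i′) + (orbit (N ∸ i′ + i) + orbit (N ∸ i))
          ≡⟨ cong (orbit (N ∸ i + i′) +_) (gap i i≤k) ⟨
        orbit (N ∸ i + i′) + (orbit (N ∸ i + i) + orbit (N ∸ i′))
          ≡⟨ cong (λ v → orbit (N ∸ i + i′) + (v + orbit (N ∸ i′))) (orbit≡0 i (<⇒≤ i<N)) ⟩
        orbit (N ∸ i + i′) + orbit (N ∸ i′)
          ≡⟨ gap i′ i′≤k ⟩
        orbit (N ∸ i′ + i′) + orbit (N ∸ i)
          ≡⟨ cong (_+ orbit (N ∸ i)) (orbit≡0 i′ (<⇒≤ i′<N)) ⟩
        0 + orbit (N ∸ i)
          ∎
        where open ≡-Reasoning
      both : orbit (N ∸ i + i′) + orbit (N ∸ i′ + i) ≡ 0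
      both = +-cancelʳ-≡ (orbit (N ∸ i)) _ 0 sum≡
      inner : ∀ {s t} → s < N → t < s → 0 < N ∸ s + t × N ∸ s + t < N
      inner {s} {t} s<N t<s = ≤-trans (m<n⇒0<n∸m s<N) (m≤m+n _ t) ,
        subst (N ∸ s + t <_) (m∸n+n≡m (<⇒≤ s<N)) (+-monoʳ-< (N ∸ s) t<s)
      by-cases : Tri (i < i′) (i ≡ i′) (i > i′) → i ≡ i′
      by-cases (tri≈ _ i≡i′ _) = i≡i′
      by-cases (tri< i<i′ _ _) = ⊥-elim (orbit-nonzero coprime _ (proj₁ (inner i′<N i<i′)) (proj₂ (inner i′<N i<i′))
                                          (m+n≡0⇒n≡0 (orbit (N ∸ i + i′)) both))
      by-cases (tri> _ _ i′<i) = ⊥-elim (orbit-nonzero coprime _ (proj₁ (inner i<N i′<i)) (proj₂ (inner i<N i′<i))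
                                          (m+n≡0⇒m≡0 (orbit (N ∸ i + i′)) both))

open Rotation using (inside; wraps)

mech-≡-from-winding : ∀ p N p′ N′ .{{_ : NonZero N}} .{{_ : NonZero N′}} →
  1 ≤ p → p < N → 1 ≤ p′ → p′ < N′ → ∀ B →
  (∀ n → n < B → Rotation.winding p N n ≡ Rotation.winding p′ N′ n) →
  ∀ n → n < B → Rotation.mech p N n ≡ Rotation.mech p′ N′ n
mech-≡-from-winding p N p′ N′ 1≤p p<N 1≤p′ p′<N′ B _ zero _ =
  trans (Rotation.Laws.mech-0 p N 1≤p p<N) (sym (Rotation.Laws.mech-0 p′ N′ 1≤p′ p′<N′))
mech-≡-from-winding p N p′ N′ 1≤p p<N 1≤p′ p′<N′ B same (suc n) 1+n<B
  with Rotation.Laws.advance p N 1≤p p<N n | Rotation.Laws.advance p′ N′ 1≤p′ p′<N′ n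
... | inside _ _ _ m | inside _ _ _ m′ = trans m (sym m′)
... | wraps _ _ _ m  | wraps _ _ _ m′  = trans m (sym m′)
... | inside _ _ w _ | wraps _ _ w′ _  = ⊥-elim (1+n≢n (sym (begin
  winding n             ≡⟨ w ⟨
  winding (suc n)       ≡⟨ same (suc n) 1+n<B ⟩
  winding′ (suc n)      ≡⟨ w′ ⟩
  suc (winding′ n)      ≡⟨ cong suc (same n (<-trans (n<1+n n) 1+n<B)) ⟨
  suc (winding n)       ∎)))
  where
  open ≡-Reasoning
  open Rotation p N using (winding)
  open Rotation p′ N′ renaming (winding to winding′)
... | wraps _ _ w _  | inside _ _ w′ _ = ⊥-elim (1+n≢n (sym (begin
  winding′ n            ≡⟨ w′ ⟨
  winding′ (suc n)      ≡⟨ same (suc n) 1+n<B ⟨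
  winding (suc n)       ≡⟨ w ⟩
  suc (winding n)       ≡⟨ cong suc (same n (<-trans (n<1+n n) 1+n<B)) ⟩
  suc (winding′ n)      ∎)))
  where
  open ≡-Reasoning
  open Rotation p N using (winding)
  open Rotation p′ N′ renaming (winding to winding′)

1≤F : ∀ n → 1 ≤ F n
1≤F zero = s≤s z≤n
1≤F (suc zero) = s≤s z≤n
1≤F (suc (suc n)) = ≤-trans (1≤F (suc n)) (m≤m+n _ _)

F-nonZero : ∀ n → NonZero (F n)
F-nonZero n = >-nonZero (1≤F n)

F≤F-suc : ∀ n → F n ≤ F (suc n)
F≤F-suc zero = ≤-refl
F≤F-suc (suc n) = m≤m+n _ _

F-mono-≤ : ∀ {m n} → m ≤ n → F m ≤ F n
F-mono-≤ {n = zero} z≤n = ≤-refl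
F-mono-≤ {m} {suc n} m≤1+n with m≤n⇒m<n∨m≡n m≤1+n
... | inj₁ m<1+n = ≤-trans (F-mono-≤ (s≤s⁻¹ m<1+n)) (F≤F-suc n)
... | inj₂ refl = ≤-refl

F[1+n]<F[2+n] : ∀ n → F (suc n) < F (suc (suc n))
F[1+n]<F[2+n] n = subst (_≤ F (suc n) + F n) (+-comm (F (suc n)) 1) (+-monoʳ-≤ (F (suc n)) (1≤F n))

n≤F : ∀ n → n ≤ F n
n≤F zero = z≤n
n≤F (suc zero) = ≤-refl
n≤F (suc (suc n)) = ≤-trans (s≤s (n≤F (suc n))) (F[1+n]<F[2+n] n)

F-pred<F : ∀ L → 2 ≤ L → F (pred L) < F L
F-pred<F (suc zero) (s≤s ())
F-pred<F (suc (suc n)) _ = F[1+n]<F[2+n] n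

2≤F[2+n] : ∀ n → 2 ≤ F (suc (suc n))
2≤F[2+n] n = +-mono-≤ (1≤F (suc n)) (1≤F n)

2+u<F[3+n] : ∀ n u → u < F (suc n) → 2 + u < F (3 + n)
2+u<F[3+n] n u u<F = +-mono-≤ (2≤F[2+n] n) u<F

twice : ℕ → ℕ
twice zero = zero
twice (suc h) = suc (suc (twice h))

data ParityView : ℕ → Set where
  even : ∀ h → ParityView (twice h)
  odd  : ∀ h → ParityView (suc (twice h))

parityView : ∀ n → ParityView n
parityView zero = even zero
parityView (suc n) with parityView n
... | even h = odd h
... | odd h = even (suc h)

h≤twice : ∀ h → h ≤ twice h
h≤twice zero = z≤n
h≤twice (suc h) = s≤s (≤-trans (h≤twice h) (n≤1+n (twice h)))

cassini-odd  : ∀ h → F (1 + twice h) * F (1 + twice h) + 1 ≡ F (twice h) * F (2 + twice h)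
cassini-even : ∀ h → F (2 + twice h) * F (2 + twice h) ≡ F (1 + twice h) * F (3 + twice h) + 1
cassini-odd zero = refl
cassini-odd (suc h) = step (F (suc (twice h))) (F (suc (suc (twice h)))) (cassini-even h)
  where
  step : ∀ x y → y * y ≡ x * (y + x) + 1 → (y + x) * (y + x) + 1 ≡ y * ((y + x) + y)
  step x y h = begin
    (y + x) * (y + x) + 1            ≡⟨ expand x y ⟩
    y * y + y * x + (x * (y + x) + 1) ≡⟨ cong (y * y + y * x +_) h ⟨
    y * y + y * x + y * y            ≡⟨ collect x y ⟩
    y * ((y + x) + y)                ∎
    where
    open ≡-Reasoning
    expand : ∀ x y → (y + x) * (y + x) + 1 ≡ y * y + y * x + (x * (y + x) + 1)
    expand = solve-∀
    collect : ∀ x y → y * y + y * x + y * y ≡ y * ((y + x) + y)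
    collect = solve-∀
cassini-even h = step (F (twice h)) (F (suc (twice h))) (cassini-odd h)
  where
  step : ∀ x y → y * y + 1 ≡ x * (y + x) → (y + x) * (y + x) ≡ y * ((y + x) + y) + 1
  step x y h = begin
    (y + x) * (y + x)                ≡⟨ expand x y ⟩
    y * y + y * x + x * (y + x)      ≡⟨ cong (y * y + y * x +_) h ⟨
    y * y + y * x + (y * y + 1)      ≡⟨ collect x y ⟩
    y * ((y + x) + y) + 1            ∎
    where
    open ≡-Reasoning
    expand : ∀ x y → (y + x) * (y + x) ≡ y * y + y * x + x * (y + x)
    expand = solve-∀
    collect : ∀ x y → y * y + y * x + (y * y + 1) ≡ y * ((y + x) + y) + 1
    collect = solve-∀

F-det-even : ∀ h → F (3 + twice h) * F (2 + twice h) ≡ F (1 + twice h) * F (4 + twice h) + 1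
F-det-even h = step (F (suc (twice h))) (F (suc (suc (twice h)))) (cassini-even h)
  where
  step : ∀ x y → y * y ≡ x * (y + x) + 1 → (y + x) * y ≡ x * ((y + x) + y) + 1
  step x y h = begin
    (y + x) * y                 ≡⟨ expand x y ⟩
    y * y + x * y               ≡⟨ cong (_+ x * y) h ⟩
    x * (y + x) + 1 + x * y     ≡⟨ collect x y ⟩
    x * ((y + x) + y) + 1       ∎
    where
    open ≡-Reasoning
    expand : ∀ x y → (y + x) * y ≡ y * y + x * y
    expand = solve-∀
    collect : ∀ x y → x * (y + x) + 1 + x * y ≡ x * ((y + x) + y) + 1
    collect = solve-∀

F-coprime-pred : ∀ L → Coprime (F L) (F (pred L))
F-coprime-pred L {d} (d∣F , d∣F-pred) with parityView L
... | even zero = ∣1⇒≡1 d∣F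
... | even (suc h) = ∣1⇒≡1 (∣m+n∣m⇒∣n (subst (d ∣_) (cassini-even h) (∣-trans d∣F (n∣m*n (F L))))
                                     (∣-trans d∣F-pred (m∣m*n _)))
... | odd h = ∣1⇒≡1 (∣m+n∣m⇒∣n (subst (d ∣_) (sym (cassini-odd h)) (∣-trans d∣F-pred (m∣m*n _)))
                              (∣-trans d∣F (n∣m*n (F L))))

-- One period of fibMech L is a conjugate of fibWord L.
fibMech : ℕ → ℕ → Bool
fibMech L = Rotation.mech (F (pred L)) (F L) {{F-nonZero L}}

fibWinding : ℕ → ℕ → ℕ
fibWinding L = Rotation.winding (F (pred L)) (F L) {{F-nonZero L}}

fibWindow : ℕ → ℕ → ℕ → Bool
fibWindow L = Rotation.window (F (pred L)) (F L) {{F-nonZero L}}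

module FibRotation (L : ℕ) (2≤L : 2 ≤ L) = Rotation.Laws (F (pred L)) (F L) {{F-nonZero L}} (1≤F (pred L)) (F-pred<F L 2≤L)

fibMech-≡ : ∀ L L′ → 2 ≤ L → 2 ≤ L′ → ∀ B →
  (∀ n → n < B → fibWinding L n ≡ fibWinding L′ n) → ∀ n → n < B → fibMech L n ≡ fibMech L′ n
fibMech-≡ L L′ 2≤L 2≤L′ = mech-≡-from-winding _ _ _ _ {{F-nonZero L}} {{F-nonZero L′}}
  (1≤F (pred L)) (F-pred<F L 2≤L) (1≤F (pred L′)) (F-pred<F L′ 2≤L′)

-- By Cassini's identity the slopes F (L ∸ 1)/F L and F L/F (L + 1) are Farey neighbours.
fibMech-suc : ∀ L → 2 ≤ L → ∀ n → n < F L → fibMech L n ≡ fibMech (suc L) n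
fibMech-suc L 2≤L with parityView L
... | even (suc h) = λ n n<F → fibMech-≡ L (suc L) 2≤L (≤-trans 2≤L (n≤1+n L)) (F (suc L))
        (det1⇒[n*p]/N≡[n*p′]/N′ (F (pred L)) (F L) (F L) (F (suc L)) {{F-nonZero L}} {{F-nonZero (suc L)}}
          (cassini-even h))
        n (<-≤-trans n<F (F≤F-suc L))
... | odd (suc h) = fibMech-≡ L (suc L) 2≤L (≤-trans 2≤L (n≤1+n L)) (F L) (λ n n<F → sym
        (det1⇒[n*p]/N≡[n*p′]/N′ (F L) (F (suc L)) (F (pred L)) (F L) {{F-nonZero (suc L)}} {{F-nonZero L}}
          (sym (cassini-odd (suc h))) n n<F))
... | even zero = ⊥-elim (<⇒≱ 2≤L z≤n)
... | odd zero = ⊥-elim (<⇒≱ 2≤L (s≤s z≤n))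

-- For even L also F (L ∸ 1)/F L and F (L + 1)/F (L + 2) are Farey neighbours.
fibMech-+2 : ∀ h n → n < F (4 + twice h) → fibMech (2 + twice h) n ≡ fibMech (4 + twice h) n
fibMech-+2 h = fibMech-≡ (2 + twice h) (4 + twice h) (s≤s (s≤s z≤n)) (s≤s (s≤s z≤n)) (F (4 + twice h))
  (det1⇒[n*p]/N≡[n*p′]/N′ (F (1 + twice h)) (F (2 + twice h)) (F (3 + twice h)) (F (4 + twice h))
    {{F-nonZero (2 + twice h)}} {{F-nonZero (4 + twice h)}} (F-det-even h))

fibMech-reflect : ∀ L → 2 ≤ L → ∀ j → 1 ≤ j → 2 + j ≤ F L → fibMech L (F L ∸ j) ≡ fibMech L (suc j)
fibMech-reflect L 2≤L = FibRotation.mech-reflect L 2≤L (F-coprime-pred L)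

fibMech-F∸-suc : ∀ L → 2 ≤ L → ∀ j → suc j < F L → fibMech L (F L ∸ j) ≡ fibMech (suc L) (F (suc L) ∸ j)
fibMech-F∸-suc L 2≤L zero _ = trans (FibRotation.mech-N L 2≤L) (sym (FibRotation.mech-N (suc L) (m≤n⇒m≤1+n 2≤L)))
fibMech-F∸-suc L 2≤L (suc j) 2+j<F = begin
  fibMech L (F L ∸ suc j)              ≡⟨ fibMech-reflect L 2≤L (suc j) (s≤s z≤n) 2+j<F ⟩
  fibMech L (2 + j)                    ≡⟨ fibMech-suc L 2≤L (2 + j) 2+j<F ⟩
  fibMech (suc L) (2 + j)              ≡⟨ fibMech-reflect (suc L) (m≤n⇒m≤1+n 2≤L) (suc j) (s≤s z≤n)
                                                          (≤-trans 2+j<F (F≤F-suc L)) ⟨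
  fibMech (suc L) (F (suc L) ∸ suc j)  ∎
  where open ≡-Reasoning

window-suc : ∀ L → 2 ≤ L → ∀ {k i r} → k < F L → i ≤ k → r < k → fibWindow L i r ≡ fibWindow (suc L) i r
window-suc L 2≤L {k} {i} {r} k<F i≤k r<k with i ≤? r
... | yes i≤r = begin
  fibMech L (suc (F L ∸ i + r))              ≡⟨ cong (fibMech L) (suc[n∸i+r]≡suc[r∸i]+n (F L) i r i≤r i≤F) ⟩
  fibMech L (suc (r ∸ i) + F L)              ≡⟨ FibRotation.mech-+N L 2≤L (suc (r ∸ i)) ⟩
  fibMech L (suc (r ∸ i))                    ≡⟨ fibMech-suc L 2≤L (suc (r ∸ i)) 1+r∸i<F ⟩
  fibMech (suc L) (suc (r ∸ i))              ≡⟨ FibRotation.mech-+N (suc L) (m≤n⇒m≤1+n 2≤L) (suc (r ∸ i)) ⟨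
  fibMech (suc L) (suc (r ∸ i) + F (suc L))  ≡⟨ cong (fibMech (suc L)) (suc[n∸i+r]≡suc[r∸i]+n (F (suc L)) i r i≤r i≤F′) ⟨
  fibMech (suc L) (suc (F (suc L) ∸ i + r))  ∎
  where
  open ≡-Reasoning
  i≤F = ≤-trans i≤k (<⇒≤ k<F)
  i≤F′ = ≤-trans i≤F (F≤F-suc L)
  1+r∸i<F = ≤-<-trans (≤-trans (s≤s (m∸n≤m r i)) r<k) k<F
... | no i≰r = begin
  fibMech L (suc (F L ∸ i + r))              ≡⟨ cong (fibMech L) (suc[n∸i+r]≡n∸[i∸suc[r]] (F L) i r r<i i≤F) ⟩
  fibMech L (F L ∸ (i ∸ suc r))              ≡⟨ fibMech-F∸-suc L 2≤L (i ∸ suc r) (≤-<-trans 1+j≤k k<F) ⟩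
  fibMech (suc L) (F (suc L) ∸ (i ∸ suc r))  ≡⟨ cong (fibMech (suc L)) (suc[n∸i+r]≡n∸[i∸suc[r]] (F (suc L)) i r r<i i≤F′) ⟨
  fibMech (suc L) (suc (F (suc L) ∸ i + r))  ∎
  where
  open ≡-Reasoning
  r<i = ≰⇒> i≰r
  i≤F = ≤-trans i≤k (<⇒≤ k<F)
  i≤F′ = ≤-trans i≤F (F≤F-suc L)
  1+j≤k : suc (i ∸ suc r) ≤ k
  1+j≤k = ≤-trans (subst (i ∸ suc r <_) (m∸n+n≡m r<i) (m<m+n (i ∸ suc r) z<s)) i≤k

window-mono : ∀ L M → 2 ≤ L → L ≤ M → ∀ {k i r} → k < F L → i ≤ k → r < k → fibWindow L i r ≡ fibWindow M i r
window-mono L zero 2≤L L≤0 k<F = ⊥-elim (<⇒≱ 2≤L (≤-trans L≤0 z≤n))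
window-mono L (suc M) 2≤L L≤1+M k<F i≤k r<k with m≤n⇒m<n∨m≡n L≤1+M
... | inj₂ refl = refl
... | inj₁ L<1+M = trans (window-mono L M 2≤L L≤M k<F i≤k r<k)
                         (window-suc M (≤-trans 2≤L L≤M) (<-≤-trans k<F (F-mono-≤ L≤M)) i≤k r<k)
  where L≤M = s≤s⁻¹ L<1+M

fibWord : ℕ → List Bool
fibWord zero = false ∷ []
fibWord (suc zero) = true ∷ []
fibWord (suc (suc n)) = fibWord (suc n) ++ fibWord n

fibLetter : ℕ → ℕ → Bool
fibLetter n = nth (fibWord n)

length-fibWord : ∀ n → length (fibWord n) ≡ F n
length-fibWord zero = refl
length-fibWord (suc zero) = refl
length-fibWord (suc (suc n)) = trans (length-++ (fibWord (suc n))) (cong₂ _+_ (length-fibWord (suc n)) (length-fibWord n))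

nth-++ˡ : ∀ xs ys i → i < length xs → nth (xs ++ ys) i ≡ nth xs i
nth-++ˡ (_ ∷ xs) ys zero _ = refl
nth-++ˡ (_ ∷ xs) ys (suc i) (s≤s i<) = nth-++ˡ xs ys i i<

nth-++ʳ : ∀ xs ys i → nth (xs ++ ys) (length xs + i) ≡ nth ys i
nth-++ʳ [] ys i = refl
nth-++ʳ (_ ∷ xs) ys i = nth-++ʳ xs ys i

fibLetter-prefix : ∀ n u → u < F (suc n) → fibLetter (2 + n) u ≡ fibLetter (suc n) u
fibLetter-prefix n u u<F = nth-++ˡ (fibWord (suc n)) (fibWord n) u (subst (u <_) (sym (length-fibWord (suc n))) u<F)

fibLetter-suffix : ∀ n v → fibLetter (2 + n) (F (suc n) + v) ≡ fibLetter n v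
fibLetter-suffix n v = trans (cong (λ w → fibLetter (2 + n) (w + v)) (sym (length-fibWord (suc n))))
                             (nth-++ʳ (fibWord (suc n)) (fibWord n) v)

fibLetter-suc : ∀ n u → 1 ≤ n → u < F n → fibLetter (suc n) u ≡ fibLetter n u
fibLetter-suc (suc n) u _ = fibLetter-prefix n u

fibLetter-mono : ∀ m n u → 1 ≤ m → m ≤ n → u < F m → fibLetter n u ≡ fibLetter m u
fibLetter-mono m zero u 1≤m m≤0 _ = ⊥-elim (<⇒≱ 1≤m m≤0)
fibLetter-mono m (suc n) u 1≤m m≤1+n u<F with m≤n⇒m<n∨m≡n m≤1+n
... | inj₂ refl = refl
... | inj₁ m<1+n = trans (fibLetter-suc n u (≤-trans 1≤m m≤n) (<-≤-trans u<F (F-mono-≤ m≤n)))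
                       (fibLetter-mono m n u 1≤m m≤n u<F)
  where m≤n = s≤s⁻¹ m<1+n

fibLetter-agree : ∀ m n u → 1 ≤ m → 1 ≤ n → u < F m → u < F n → fibLetter m u ≡ fibLetter n u
fibLetter-agree m n u 1≤m 1≤n u<Fm u<Fn with ≤-total m n
... | inj₁ m≤n = sym (fibLetter-mono m n u 1≤m m≤n u<Fm)
... | inj₂ n≤m = fibLetter-mono n m u 1≤n n≤m u<Fn

concatMap-φ-fibWord : ∀ n → concatMap φ (fibWord n) ≡ fibWord (suc n)
concatMap-φ-fibWord zero = refl
concatMap-φ-fibWord (suc zero) = refl
concatMap-φ-fibWord (suc (suc n)) =
  trans (concatMap-++ φ (fibWord (suc n)) (fibWord n)) (cong₂ _++_ (concatMap-φ-fibWord (suc n)) (concatMap-φ-fibWord n))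

φⁿ≡fibWord : ∀ n → φⁿ n ≡ fibWord (suc n)
φⁿ≡fibWord zero = refl
φⁿ≡fibWord (suc n) = trans (cong (concatMap φ) (φⁿ≡fibWord n)) (concatMap-φ-fibWord (suc n))

x≡fibLetter : ∀ i → x i ≡ fibLetter (suc i) (i ∸ 1)
x≡fibLetter i = cong (λ w → nth w (i ∸ 1)) (φⁿ≡fibWord i)

FibArray : ∀ {r s} → ℕ → ℕ → Array r s → Set
FibArray m n w = ∀ i j → w i j ≡ letter (fibLetter m (toℕ i)) (fibLetter n (toℕ j))

⊖-FibArray : ∀ m n {u : Array (F (suc m)) (F n)} {v : Array (F m) (F n)} →
  FibArray (suc m) n u → FibArray m n v → FibArray (2 + m) n (u ⊖ v)
⊖-FibArray m n fib-u fib-v i j with splitAt (F (suc m)) i in eq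
... | inj₁ i′ = trans (fib-u i′ j) (cong (λ w → letter w (fibLetter n (toℕ j))) (sym (trans
      (cong (fibLetter (2 + m)) (trans (cong toℕ (sym (splitAt⁻¹-↑ˡ eq))) (toℕ-↑ˡ i′ (F m))))
      (fibLetter-prefix m (toℕ i′) (toℕ<n i′)))))
... | inj₂ i′ = trans (fib-v i′ j) (cong (λ w → letter w (fibLetter n (toℕ j))) (sym (trans
      (cong (fibLetter (2 + m)) (trans (cong toℕ (sym (splitAt⁻¹-↑ʳ eq))) (toℕ-↑ʳ (F (suc m)) i′)))
      (fibLetter-suffix m (toℕ i′)))))

⦶-FibArray : ∀ m n {u : Array (F m) (F (suc n))} {v : Array (F m) (F n)} →
  FibArray m (suc n) u → FibArray m n v → FibArray m (2 + n) (u ⦶ v)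
⦶-FibArray m n fib-u fib-v i j with splitAt (F (suc n)) j in eq
... | inj₁ j′ = trans (fib-u i j′) (cong (letter (fibLetter m (toℕ i))) (sym (trans
      (cong (fibLetter (2 + n)) (trans (cong toℕ (sym (splitAt⁻¹-↑ˡ eq))) (toℕ-↑ˡ j′ (F n))))
      (fibLetter-prefix n (toℕ j′) (toℕ<n j′)))))
... | inj₂ j′ = trans (fib-v i j′) (cong (letter (fibLetter m (toℕ i))) (sym (trans
      (cong (fibLetter (2 + n)) (trans (cong toℕ (sym (splitAt⁻¹-↑ʳ eq))) (toℕ-↑ʳ (F (suc n)) j′)))
      (fibLetter-suffix n (toℕ j′)))))

fw-FibArray : ∀ m n → FibArray m n (fw m n)
fw-FibArray zero zero Fin.zero Fin.zero = refl
fw-FibArray zero (suc zero) Fin.zero Fin.zero = refl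
fw-FibArray (suc zero) zero Fin.zero Fin.zero = refl
fw-FibArray (suc zero) (suc zero) Fin.zero Fin.zero = refl
fw-FibArray (suc (suc m)) zero = ⊖-FibArray m 0 (fw-FibArray (suc m) zero) (fw-FibArray m zero)
fw-FibArray (suc (suc m)) (suc zero) = ⊖-FibArray m 1 (fw-FibArray (suc m) 1) (fw-FibArray m 1)
fw-FibArray zero (suc (suc n)) = ⦶-FibArray 0 n (fw-FibArray zero (suc n)) (fw-FibArray zero n)
fw-FibArray (suc zero) (suc (suc n)) = ⦶-FibArray 1 n (fw-FibArray 1 (suc n)) (fw-FibArray 1 n)
fw-FibArray (suc (suc m)) (suc (suc n)) =
  ⦶-FibArray (2 + m) n (fw-FibArray (2 + m) (suc n)) (fw-FibArray (2 + m) n)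

fibMech-even-+F : ∀ h v → v < F (2 + twice h) →
  fibMech (2 + twice h) (2 + v) ≡ fibMech (4 + twice h) (F (3 + twice h) + (2 + v))
fibMech-even-+F h v v<F with <-cmp (2 + v) (F K)
  where K = 2 + twice h
... | tri< 2+v<F _ _ = begin
  fibMech K (2 + v)                   ≡⟨ fibMech-reflect K 2≤K (suc v) (s≤s z≤n) 2+v<F ⟨
  fibMech K (F K ∸ suc v)             ≡⟨ cong (fibMech K) (suc[m∸suc[n]]≡m∸n (F K) (suc v) (<⇒≤ 2+v<F)) ⟨
  fibMech K (suc j)                   ≡⟨ fibMech-+2 h (suc j) (≤-trans 2+j≤F[K] F[K]≤F[L]) ⟩
  fibMech L (suc j)                   ≡⟨ fibMech-reflect L 2≤L j 1≤j (≤-trans 2+j≤F[K] F[K]≤F[L]) ⟨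
  fibMech L (F L ∸ j)                 ≡⟨ cong (fibMech L) F[L]∸j ⟩
  fibMech L (F (suc K) + (2 + v))     ∎
  where
  open ≡-Reasoning
  K = 2 + twice h
  L = 2 + K
  2≤K = m≤m+n 2 (twice h)
  2≤L = m≤m+n 2 K
  j = F K ∸ (2 + v)
  1≤j : 1 ≤ j
  1≤j = m<n⇒0<n∸m 2+v<F
  2+j≤F[K] : 2 + j ≤ F K
  2+j≤F[K] = subst (_≤ F K) (+-comm j 2) (subst (j + 2 ≤_) (m∸n+n≡m (<⇒≤ 2+v<F)) (+-monoʳ-≤ j (s≤s (s≤s z≤n))))
  F[K]≤F[L] : F K ≤ F L
  F[K]≤F[L] = F-mono-≤ (m≤n+m K 2)
  F[L]∸j : F L ∸ j ≡ F (suc K) + (2 + v)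
  F[L]∸j = begin
    F (suc K) + F K ∸ j    ≡⟨ +-∸-assoc (F (suc K)) (m∸n≤m (F K) (2 + v)) ⟩
    F (suc K) + (F K ∸ j)  ≡⟨ cong (F (suc K) +_) (m∸[m∸n]≡n (<⇒≤ 2+v<F)) ⟩
    F (suc K) + (2 + v)    ∎
... | tri≈ _ 2+v≡F _ = begin
  fibMech K (2 + v)                ≡⟨ cong (fibMech K) 2+v≡F ⟩
  fibMech K (F K)                  ≡⟨ FibRotation.mech-N K (m≤m+n 2 (twice h)) ⟩
  true                             ≡⟨ FibRotation.mech-N L (m≤m+n 2 K) ⟨
  fibMech L (F (suc K) + F K)      ≡⟨ cong (λ w → fibMech L (F (suc K) + w)) 2+v≡F ⟨
  fibMech L (F (suc K) + (2 + v))  ∎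
  where
  open ≡-Reasoning
  K = 2 + twice h
  L = 2 + K
... | tri> _ _ F<2+v = begin
  fibMech K (2 + v)                ≡⟨ cong (fibMech K) 2+v≡ ⟩
  fibMech K (1 + F K)              ≡⟨ FibRotation.mech-+N K (m≤m+n 2 (twice h)) 1 ⟩
  fibMech K 1                      ≡⟨ FibRotation.mech-1 K (m≤m+n 2 (twice h)) ⟩
  false                            ≡⟨ FibRotation.mech-1 L (m≤m+n 2 K) ⟨
  fibMech L 1                      ≡⟨ FibRotation.mech-+N L (m≤m+n 2 K) 1 ⟨
  fibMech L (1 + F L)              ≡⟨ cong (fibMech L) 1+F[L]≡ ⟩
  fibMech L (F (suc K) + (2 + v))  ∎
  where
  open ≡-Reasoning
  K = 2 + twice h
  L = 2 + K
  2+v≡ : 2 + v ≡ 1 + F K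
  2+v≡ = ≤-antisym (s≤s v<F) F<2+v
  1+F[L]≡ : 1 + F L ≡ F (suc K) + (2 + v)
  1+F[L]≡ = trans (+-comm 1 (F (suc K) + F K)) (trans (+-assoc (F (suc K)) (F K) 1)
              (cong (F (suc K) +_) (trans (+-comm (F K) 1) (sym 2+v≡))))

-- fibWord (L + 2) = fibWord L · fibWord (L ∸ 1) · fibWord L; each block is handled separately.
fibLetter-even : ∀ h u → u < F (2 + twice h) → fibLetter (2 + twice h) u ≡ fibMech (2 + twice h) (2 + u)
fibLetter-even zero zero _ = refl
fibLetter-even zero (suc zero) _ = refl
fibLetter-even zero (suc (suc u)) (s≤s (s≤s ()))
fibLetter-even (suc h) u u<F with u <? F K | u <? F (suc K)
  where K = 2 + twice h
... | yes u<F[K] | _ = begin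
  fibLetter L u        ≡⟨ fibLetter-prefix K u (<-≤-trans u<F[K] (F≤F-suc K)) ⟩
  fibLetter (suc K) u  ≡⟨ fibLetter-prefix (suc (twice h)) u u<F[K] ⟩
  fibLetter K u        ≡⟨ fibLetter-even h u u<F[K] ⟩
  fibMech K (2 + u)    ≡⟨ fibMech-+2 h (2 + u) (2+u<F[3+n] (suc (twice h)) u u<F[K]) ⟩
  fibMech L (2 + u)    ∎
  where
  open ≡-Reasoning
  K = 2 + twice h
  L = 2 + K
... | no u≮F[K] | yes u<F[1+K] = begin
  fibLetter L u                ≡⟨ fibLetter-prefix K u u<F[1+K] ⟩
  fibLetter (suc K) u          ≡⟨ cong (fibLetter (suc K)) u≡ ⟨
  fibLetter (suc K) (F K + v)  ≡⟨ fibLetter-suffix (suc (twice h)) v ⟩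
  fibLetter (suc (twice h)) v  ≡⟨ fibLetter-prefix (twice h) v v<F ⟨
  fibLetter K v                ≡⟨ fibLetter-even h v (<-≤-trans v<F (F≤F-suc (suc (twice h)))) ⟩
  fibMech K (2 + v)            ≡⟨ FibRotation.mech-+N K (m≤m+n 2 (twice h)) (2 + v) ⟨
  fibMech K (2 + v + F K)      ≡⟨ fibMech-+2 h (2 + v + F K) bound ⟩
  fibMech L (2 + v + F K)      ≡⟨ cong (λ w → fibMech L (2 + w)) (trans (+-comm v (F K)) u≡) ⟩
  fibMech L (2 + u)            ∎
  where
  open ≡-Reasoning
  K = 2 + twice h
  L = 2 + K
  v = u ∸ F K
  u≡ : F K + v ≡ u
  u≡ = m+[n∸m]≡n (≮⇒≥ u≮F[K])
  v<F : v < F (suc (twice h))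
  v<F = +-cancelˡ-< (F K) v _ (subst (_< F (suc K)) (sym u≡) u<F[1+K])
  bound : 2 + v + F K < F L
  bound = +-monoˡ-< (F K) (2+u<F[3+n] (twice h) v v<F)
... | no u≮F[K] | no u≮F[1+K] = begin
  fibLetter L u                    ≡⟨ cong (fibLetter L) u≡ ⟨
  fibLetter L (F (suc K) + v)      ≡⟨ fibLetter-suffix K v ⟩
  fibLetter K v                    ≡⟨ fibLetter-even h v v<F ⟩
  fibMech K (2 + v)                ≡⟨ fibMech-even-+F h v v<F ⟩
  fibMech L (F (suc K) + (2 + v))  ≡⟨ cong (fibMech L) (trans (+-suc (F (suc K)) (suc v))
                                                           (cong suc (trans (+-suc (F (suc K)) v) (cong suc u≡)))) ⟩
  fibMech L (2 + u)                ∎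
  where
  open ≡-Reasoning
  K = 2 + twice h
  L = 2 + K
  v = u ∸ F (suc K)
  u≡ : F (suc K) + v ≡ u
  u≡ = m+[n∸m]≡n (≮⇒≥ u≮F[1+K])
  v<F : v < F K
  v<F = +-cancelˡ-< (F (suc K)) v (F K) (subst (_< F L) (sym u≡) u<F)

fibMech-odd-shift : ∀ h n → 2 ≤ n → n ≤ suc (F (3 + twice h)) →
  fibMech (4 + twice h) n ≡ fibMech (3 + twice h) (n + F (1 + twice h))
fibMech-odd-shift h n 2≤n n≤ with <-cmp n (F (2 + twice h))
... | tri< n<F _ _ = begin
  fibMech (suc L) n          ≡⟨ fibMech-+2 h n (<-≤-trans n<F (≤-trans (F≤F-suc K) (F≤F-suc L))) ⟨
  fibMech K n                ≡⟨ cong (fibMech K) n≡ ⟨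
  fibMech K (suc (n ∸ 1))    ≡⟨ fibMech-reflect K 2≤K (n ∸ 1) (∸-monoˡ-≤ 1 2≤n) (subst (_< F K) (sym n≡) n<F) ⟨
  fibMech K (F K ∸ (n ∸ 1))  ≡⟨ cong (fibMech K) 1+j≡ ⟨
  fibMech K (suc j)          ≡⟨ fibMech-+2 h (suc j) (≤-trans 2+j≤F[L] (F≤F-suc L)) ⟩
  fibMech (suc L) (suc j)    ≡⟨ fibMech-suc L 2≤L (suc j) 2+j≤F[L] ⟨
  fibMech L (suc j)          ≡⟨ fibMech-reflect L 2≤L j (m<n⇒0<n∸m n<F) 2+j≤F[L] ⟨
  fibMech L (F L ∸ j)        ≡⟨ cong (fibMech L) F[L]∸j ⟩
  fibMech L (n + F (1 + twice h)) ∎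
  where
  open ≡-Reasoning
  K = 2 + twice h
  L = suc K
  2≤K = m≤m+n 2 (twice h)
  2≤L = m≤n⇒m≤1+n 2≤K
  j = F K ∸ n
  n≡ : suc (n ∸ 1) ≡ n
  n≡ = trans (+-comm 1 (n ∸ 1)) (m∸n+n≡m (≤-trans (s≤s z≤n) 2≤n))
  1+j≡ : suc j ≡ F K ∸ (n ∸ 1)
  1+j≡ = trans (cong (λ w → suc (F K ∸ w)) (sym n≡))
               (suc[m∸suc[n]]≡m∸n (F K) (n ∸ 1) (subst (_≤ F K) (sym n≡) (<⇒≤ n<F)))
  2+j≤F[L] : 2 + j ≤ F L
  2+j≤F[L] = ≤-trans (subst (_≤ F K) (+-comm j 2) (subst (j + 2 ≤_) (m∸n+n≡m (<⇒≤ n<F)) (+-monoʳ-≤ j 2≤n)))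
                     (F≤F-suc K)
  F[L]∸j : F L ∸ j ≡ n + F (1 + twice h)
  F[L]∸j = begin
    F K + F (1 + twice h) ∸ j      ≡⟨ +-∸-comm (F (1 + twice h)) (m∸n≤m (F K) n) ⟩
    (F K ∸ j) + F (1 + twice h)    ≡⟨ cong (_+ F (1 + twice h)) (m∸[m∸n]≡n (<⇒≤ n<F)) ⟩
    n + F (1 + twice h)            ∎
... | tri≈ _ n≡F _ = begin
  fibMech (suc L) n          ≡⟨ fibMech-+2 h n (subst (_< F (suc L)) (sym n≡F)
                                  (<-≤-trans (F[1+n]<F[2+n] (suc (twice h))) (F≤F-suc L))) ⟨
  fibMech K n                ≡⟨ cong (fibMech K) n≡F ⟩
  fibMech K (F K)            ≡⟨ FibRotation.mech-N K (m≤m+n 2 (twice h)) ⟩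
  true                       ≡⟨ FibRotation.mech-N L (m≤m+n 2 (suc (twice h))) ⟨
  fibMech L (F K + F (1 + twice h)) ≡⟨ cong (λ w → fibMech L (w + F (1 + twice h))) n≡F ⟨
  fibMech L (n + F (1 + twice h)) ∎
  where
  open ≡-Reasoning
  K = 2 + twice h
  L = suc K
... | tri> _ _ F<n = begin
  fibMech (suc L) n          ≡⟨ fibMech-+2 h n n<F[1+L] ⟨
  fibMech K n                ≡⟨ cong (fibMech K) w+F≡n ⟨
  fibMech K (w + F K)        ≡⟨ FibRotation.mech-+N K 2≤K w ⟩
  fibMech K w                ≡⟨ fibMech-+2 h w (≤-trans w<F[L] (F≤F-suc L)) ⟩
  fibMech (suc L) w          ≡⟨ fibMech-suc L 2≤L w w<F[L] ⟨
  fibMech L w                ≡⟨ FibRotation.mech-+N L 2≤L w ⟨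
  fibMech L (w + F L)        ≡⟨ trans (cong (fibMech L) (sym (+-assoc w (F K) _)))
                                      (cong (λ v → fibMech L (v + F (1 + twice h))) w+F≡n) ⟩
  fibMech L (n + F (1 + twice h)) ∎
  where
  open ≡-Reasoning
  K = 2 + twice h
  L = suc K
  2≤K = m≤m+n 2 (twice h)
  2≤L = m≤n⇒m≤1+n 2≤K
  w = n ∸ F K
  w+F≡n : w + F K ≡ n
  w+F≡n = m∸n+n≡m (<⇒≤ F<n)
  n<F[1+L] : n < F (suc L)
  n<F[1+L] = ≤-trans (s≤s n≤) (subst (2 + F L ≤_) (+-comm (F K) (F L)) (+-monoˡ-≤ (F L) (2≤F[2+n] (twice h))))
  w<F[L] : w < F L
  w<F[L] = +-cancelʳ-< (F K) w (F L) (subst (_< F L + F K) (sym w+F≡n) n<F[1+L])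

isEven-twice : ∀ h → isEven (twice h) ≡ true
isEven-twice zero = refl
isEven-twice (suc h) rewrite isEven-twice h = refl

expo-twice : ∀ h → expo (twice h) ≡ F (twice h) ∸ 1
expo-twice h rewrite isEven-twice h = refl

expo-suc-twice : ∀ h → expo (suc (twice h)) ≡ F (twice h) ∸ 1
expo-suc-twice h rewrite isEven-twice h = refl

expo≤F : ∀ m → expo m ≤ F m
expo≤F m with isEven m
... | true = m∸n≤m (F m) 1
... | false = ≤-trans (m∸n≤m (F (m ∸ 1)) 1) (F-mono-≤ (m∸n≤m m 1))

-- The offset suc (F m ∸ expo m) is 2 for even m and F (m ∸ 2) + 2 for odd m.
fibLetter-rotation : ∀ m → 2 ≤ m → ∀ u → u < F m → fibLetter m u ≡ fibMech m (u + suc (F m ∸ expo m))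
fibLetter-rotation m 2≤m u u<F with parityView m
... | even zero = ⊥-elim (<⇒≱ 2≤m z≤n)
... | odd zero = ⊥-elim (<⇒≱ 2≤m (s≤s z≤n))
... | even (suc h) = trans (fibLetter-even h u u<F) (cong (fibMech K) (trans (+-comm 2 u)
                      (cong (λ w → u + suc w) (sym (trans (cong (F K ∸_) (expo-twice (suc h))) (m∸[m∸n]≡n (1≤F K)))))))
  where K = 2 + twice h
... | odd (suc h) = begin
  fibLetter L u                        ≡⟨ fibLetter-prefix K u u<F ⟨
  fibLetter (suc L) u                  ≡⟨ fibLetter-even (suc h) u (<-≤-trans u<F (F≤F-suc L)) ⟩
  fibMech (suc L) (2 + u)              ≡⟨ fibMech-odd-shift h (2 + u) (s≤s (s≤s z≤n)) (s≤s u<F) ⟩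
  fibMech L (2 + u + F (1 + twice h))  ≡⟨ cong (fibMech L) (trans (regroup u (F (1 + twice h)))
                                                                   (cong (λ w → u + suc w) (sym offset))) ⟩
  fibMech L (u + suc (F L ∸ expo L))   ∎
  where
  open ≡-Reasoning
  K = 2 + twice h
  L = suc K
  offset : F L ∸ expo L ≡ F (1 + twice h) + 1
  offset = begin
    F L ∸ expo L                           ≡⟨ cong (F L ∸_) (expo-suc-twice (suc h)) ⟩
    F K + F (1 + twice h) ∸ (F K ∸ 1)      ≡⟨ +-∸-comm (F (1 + twice h)) (m∸n≤m (F K) 1) ⟩
    F K ∸ (F K ∸ 1) + F (1 + twice h)      ≡⟨ cong (_+ F (1 + twice h)) (m∸[m∸n]≡n (1≤F K)) ⟩
    1 + F (1 + twice h)                    ≡⟨ +-comm 1 _ ⟩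
    F (1 + twice h) + 1                    ∎
  regroup : ∀ u b → 2 + u + b ≡ u + (1 + (b + 1))
  regroup = solve-∀

x≡fibMech : ∀ h p → 1 ≤ p → suc p < F (4 + twice h) → x p ≡ fibMech (2 + twice h) (suc p)
x≡fibMech h (suc p) _ 2+p<F = begin
  x (suc p)                     ≡⟨ x≡fibLetter (suc p) ⟩
  fibLetter (2 + p) p           ≡⟨ fibLetter-agree (2 + p) (4 + twice h) p (s≤s z≤n) (s≤s z≤n)
                                     (≤-trans (n≤1+n (suc p)) (n≤F (2 + p))) p<F ⟩
  fibLetter (4 + twice h) p     ≡⟨ fibLetter-even (suc h) p p<F ⟩
  fibMech (4 + twice h) (2 + p) ≡⟨ fibMech-+2 h (2 + p) 2+p<F ⟨
  fibMech (2 + twice h) (2 + p) ∎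
  where
  open ≡-Reasoning
  p<F : p < F (4 + twice h)
  p<F = <-trans (n≤1+n (suc p)) 2+p<F

iter-comm : ∀ {A : Set} e (f : A → A) y → iter e f (f y) ≡ f (iter e f y)
iter-comm zero f y = refl
iter-comm (suc e) f y = cong f (iter-comm e f y)

iter-rows : ∀ {p q} (g : Fin p → Fin p) e (w : Array p q) i j →
  iter e (λ v i j → v (g i) j) w i j ≡ w (iter e g i) j
iter-rows g zero w i j = refl
iter-rows g (suc e) w i j = trans (iter-rows g e w (g i) j) (cong (λ v → w v j) (iter-comm e g i))

iter-cols : ∀ {p q} (g : Fin q → Fin q) e (w : Array p q) i j →
  iter e (λ v i j → v i (g j)) w i j ≡ w i (iter e g j)
iter-cols g zero w i j = refl
iter-cols g (suc e) w i j = trans (iter-cols g e w i (g j)) (cong (w i) (iter-comm e g j))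

toℕ-iter-next : ∀ {q} .{{_ : NonZero q}} e (j : Fin q) → toℕ (iter e next j) ≡ (toℕ j + e) % q
toℕ-iter-next {q} zero j = sym (trans (cong (_% q) (+-identityʳ (toℕ j))) (m<n⇒m%n≡m (toℕ<n j)))
toℕ-iter-next {suc q} (suc e) j = begin
  toℕ (next (iter e next j))          ≡⟨ toℕ-fromℕ< _ ⟩
  suc (toℕ (iter e next j)) % suc q   ≡⟨ cong (λ v → suc v % suc q) (toℕ-iter-next e j) ⟩
  (1 + (toℕ j + e) % suc q) % suc q   ≡⟨ cong (_% suc q) (+-comm 1 _) ⟩
  ((toℕ j + e) % suc q + 1) % suc q   ≡⟨ [m%n+k]%n≡[m+k]%n (toℕ j + e) 1 (suc q) ⟩
  (toℕ j + e + 1) % suc q             ≡⟨ cong (_% suc q) (trans (+-assoc (toℕ j) e 1) (cong (toℕ j +_) (+-comm e 1))) ⟩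
  (toℕ j + suc e) % suc q             ∎
  where open ≡-Reasoning

toℕ-iter-prev : ∀ {q} .{{_ : NonZero q}} e (j : Fin q) → toℕ (iter e prev j) ≡ (toℕ j + e * (q ∸ 1)) % q
toℕ-iter-prev {q} zero j = sym (trans (cong (_% q) (+-identityʳ (toℕ j))) (m<n⇒m%n≡m (toℕ<n j)))
toℕ-iter-prev {suc q} (suc e) j = begin
  toℕ (prev (iter e prev j))                     ≡⟨ toℕ-fromℕ< _ ⟩
  (toℕ (iter e prev j) + q) % suc q              ≡⟨ cong (λ v → (v + q) % suc q) (toℕ-iter-prev e j) ⟩
  ((toℕ j + e * q) % suc q + q) % suc q          ≡⟨ [m%n+k]%n≡[m+k]%n (toℕ j + e * q) q (suc q) ⟩
  (toℕ j + e * q + q) % suc q                    ≡⟨ cong (_% suc q) (regroup (toℕ j) e q) ⟩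
  (toℕ j + suc e * q) % suc q                    ∎
  where
  open ≡-Reasoning
  regroup : ∀ t e q → t + e * q + q ≡ t + (q + e * q)
  regroup = solve-∀

fibLetter-shift : ∀ m → 2 ≤ m → ∀ i → i ≤ F m → (R : Fin (F m)) →
  fibLetter m (toℕ (iter (expo m) next (iter i prev R))) ≡ fibWindow m i (toℕ R)
fibLetter-shift m 2≤m i i≤N R = begin
  fibLetter m (toℕ (iter e next (iter i prev R)))  ≡⟨ cong (fibLetter m) index ⟩
  fibLetter m (Y % N)                    ≡⟨ fibLetter-rotation m 2≤m (Y % N) (m%n<n Y N) ⟩
  fibMech m (Y % N + o)                  ≡⟨ FibRotation.mech-% m 2≤m Y o ⟩
  fibMech m (X % N + e + o)              ≡⟨ cong (fibMech m) (+-assoc (X % N) e o) ⟩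
  fibMech m (X % N + (e + o))            ≡⟨ FibRotation.mech-% m 2≤m X (e + o) ⟩
  fibMech m (X + (e + o))                ≡⟨ cong (λ v → fibMech m (X + v)) e+o≡ ⟩
  fibMech m (X + suc N)                  ≡⟨ cong (fibMech m) (r+i*[N∸1]+suc[N]≡suc[N∸i+r]+i*N N (toℕ R) i i≤N) ⟩
  fibMech m (suc (N ∸ i + toℕ R) + i * N) ≡⟨ FibRotation.mech-periodic m 2≤m (suc (N ∸ i + toℕ R)) i ⟩
  fibWindow m i (toℕ R)                  ∎
  where
  open ≡-Reasoning
  instance
    F-m-nonZero : NonZero (F m)
    F-m-nonZero = F-nonZero m
  N = F m
  e = expo m
  o = suc (N ∸ e)
  X = toℕ R + i * (N ∸ 1)
  Y = X % N + e
  index : toℕ (iter e next (iter i prev R)) ≡ Y % N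
  index = trans (toℕ-iter-next e (iter i prev R)) (cong (λ v → (v + e) % N) (toℕ-iter-prev i R))
  e+o≡ : e + o ≡ suc N
  e+o≡ = trans (+-suc e (N ∸ e)) (cong suc (m+[n∸m]≡n (expo≤F m)))

P≡letter-windows : ∀ m n k l (k< : k < F m) (l< : l < F n) i j → 2 ≤ m → 2 ≤ n → i ≤ k → j ≤ l →
  ∀ r s → P m n k l k< l< i j r s ≡ letter (fibWindow m i (toℕ r)) (fibWindow n j (toℕ s))
P≡letter-windows m n k l k< l< i j 2≤m 2≤n i≤k j≤l r s = begin
  iter i Trow⁻¹ (iter j Tcol⁻¹ (q m n)) r₀ s₀             ≡⟨ iter-rows prev i _ r₀ s₀ ⟩
  iter j Tcol⁻¹ (q m n) r₁ s₀                              ≡⟨ iter-cols prev j _ r₁ s₀ ⟩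
  q m n r₁ s₁                                              ≡⟨ iter-rows next (expo m) _ r₁ s₁ ⟩
  iter (expo n) Tcol (fw m n) r₂ s₁                        ≡⟨ iter-cols next (expo n) _ r₂ s₁ ⟩
  fw m n r₂ s₂                                             ≡⟨ fw-FibArray m n r₂ s₂ ⟩
  letter (fibLetter m (toℕ r₂)) (fibLetter n (toℕ s₂))     ≡⟨ cong₂ letter row col ⟩
  letter (fibWindow m i (toℕ r)) (fibWindow n j (toℕ s))   ∎
  where
  open ≡-Reasoning
  r₀ = inject≤ r (<⇒≤ k<)
  s₀ = inject≤ s (<⇒≤ l<)
  r₁ = iter i prev r₀
  s₁ = iter j prev s₀
  r₂ = iter (expo m) next r₁
  s₂ = iter (expo n) next s₁
  row : fibLetter m (toℕ r₂) ≡ fibWindow m i (toℕ r)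
  row = trans (fibLetter-shift m 2≤m i (≤-trans i≤k (<⇒≤ k<)) r₀) (cong (fibWindow m i) (toℕ-inject≤ r (<⇒≤ k<)))
  col : fibLetter n (toℕ s₂) ≡ fibWindow n j (toℕ s)
  col = trans (fibLetter-shift n 2≤n j (≤-trans j≤l (<⇒≤ l<)) s₀) (cong (fibWindow n j) (toℕ-inject≤ s (<⇒≤ l<)))

n≤2+twice[n] : ∀ n → n ≤ 2 + twice n
n≤2+twice[n] n = ≤-trans (h≤twice n) (m≤n+m (twice n) 2)

-- Both directions pass to an even level M ≥ m at which x agrees with fibMech M far enough.
fibWindow-factor : ∀ m k i → 2 ≤ m → k < F m → i ≤ k →
  Σ ℕ λ p → ∀ r → r < k → fibWindow m i r ≡ x (suc (p + r))
fibWindow-factor m k i 2≤m k<F i≤k = pred (F M ∸ i) , λ r r<k → begin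
  fibWindow m i r                          ≡⟨ window-mono m M 2≤m m≤M k<F i≤k r<k ⟩
  fibMech M (suc (F M ∸ i + r))            ≡⟨ cong (λ v → fibMech M (suc (v + r)))
                                                   (suc-pred (F M ∸ i) {{>-nonZero 0<F∸i}}) ⟨
  fibMech M (suc (suc (pred (F M ∸ i)) + r)) ≡⟨ x≡fibMech (m + k) (suc (pred (F M ∸ i) + r)) (s≤s z≤n) (bound r r<k) ⟨
  x (suc (pred (F M ∸ i) + r))             ∎
  where
  open ≡-Reasoning
  M = 2 + twice (m + k)
  m≤M : m ≤ M
  m≤M = ≤-trans (m≤m+n m k) (n≤2+twice[n] (m + k))
  k<F[M] : k < F M
  k<F[M] = <-≤-trans k<F (F-mono-≤ m≤M)
  0<F∸i : 0 < F M ∸ i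
  0<F∸i = m<n⇒0<n∸m (≤-<-trans i≤k k<F[M])
  bound : ∀ r → r < k → suc (suc (pred (F M ∸ i) + r)) < F (2 + M)
  bound r r<k = subst (λ v → suc (v + r) < F (2 + M)) (sym (suc-pred (F M ∸ i) {{>-nonZero 0<F∸i}}))
    (≤-<-trans (s≤s (+-monoˡ-≤ r (m∸n≤m (F M) i)))
      (subst (suc (F M + r) <_) (+-comm (F M) (F (suc M)))
        (subst (_< F M + F (suc M)) (+-suc (F M) r) (+-monoʳ-< (F M) (≤-<-trans r<k (<-≤-trans k<F[M] (F≤F-suc M)))))))

factor-fibWindow : ∀ m k p → 2 ≤ m → k < F m →
  Σ ℕ λ i → i ≤ k × (∀ r → r < k → x (suc (p + r)) ≡ fibWindow m i r)
factor-fibWindow m k p 2≤m k<F with FibRotation.window-complete M (m≤m+n 2 _) (suc p) k k<F[M]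
  where
  M = 2 + twice (m + p + k)
  k<F[M] = <-≤-trans k<F (F-mono-≤ (≤-trans (≤-trans (m≤m+n m p) (m≤m+n (m + p) k)) (n≤2+twice[n] (m + p + k))))
... | i , i≤k , same = i , i≤k , λ r r<k → begin
  x (suc (p + r))                ≡⟨ x≡fibMech (m + p + k) (suc (p + r)) (s≤s z≤n) (bound r r<k) ⟩
  fibMech M (suc (suc (p + r)))  ≡⟨ same r r<k ⟩
  fibWindow M i r                ≡⟨ window-mono m M 2≤m m≤M k<F i≤k r<k ⟨
  fibWindow m i r                ∎
  where
  open ≡-Reasoning
  M = 2 + twice (m + p + k)
  m≤M : m ≤ M
  m≤M = ≤-trans (≤-trans (m≤m+n m p) (m≤m+n (m + p) k)) (n≤2+twice[n] (m + p + k))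
  p+k≤M : p + k ≤ M
  p+k≤M = ≤-trans (m≤n+m (p + k) m) (≤-trans (≤-reflexive (sym (+-assoc m p k))) (n≤2+twice[n] (m + p + k)))
  bound : ∀ r → r < k → suc (suc (p + r)) < F (2 + M)
  bound r r<k = <-≤-trans (s≤s (s≤s (+-monoʳ-< p r<k))) (≤-trans (s≤s (s≤s p+k≤M)) (n≤F (2 + M)))

rowBit : Letter → Bool
rowBit Defs.a = false
rowBit Defs.b = false
rowBit Defs.c = true
rowBit Defs.d = true

colBit : Letter → Bool
colBit Defs.a = false
colBit Defs.b = true
colBit Defs.c = false
colBit Defs.d = true

rowBit-letter : ∀ u v → rowBit (letter u v) ≡ u
rowBit-letter true true = refl
rowBit-letter true false = refl
rowBit-letter false true = refl
rowBit-letter false false = refl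

colBit-letter : ∀ u v → colBit (letter u v) ≡ v
colBit-letter true true = refl
colBit-letter true false = refl
colBit-letter false true = refl
colBit-letter false false = refl

letter-injective : ∀ {u v u′ v′} → letter u v ≡ letter u′ v′ → u ≡ u′ × v ≡ v′
letter-injective {u} {v} {u′} {v′} eq =
  trans (sym (rowBit-letter u v)) (trans (cong rowBit eq) (rowBit-letter u′ v′)) ,
  trans (sym (colBit-letter u v)) (trans (cong colBit eq) (colBit-letter u′ v′))

1≤k<F⇒2≤m : ∀ m {k} → 1 ≤ k → k < F m → 2 ≤ m
1≤k<F⇒2≤m zero 1≤k k<F = ⊥-elim (<⇒≱ k<F 1≤k)
1≤k<F⇒2≤m (suc zero) 1≤k k<F = ⊥-elim (<⇒≱ k<F 1≤k)
1≤k<F⇒2≤m (suc (suc m)) _ _ = s≤s (s≤s z≤n)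

module Prefixes (m n k l : ℕ) (1≤k : 1 ≤ k) (k< : k < F m) (1≤l : 1 ≤ l) (l< : l < F n) where

  2≤m = 1≤k<F⇒2≤m m 1≤k k<
  2≤n = 1≤k<F⇒2≤m n 1≤l l<

  P-letter : ∀ i j → i ≤ k → j ≤ l →
             ∀ r s → P m n k l k< l< i j r s ≡ letter (fibWindow m i (toℕ r)) (fibWindow n j (toℕ s))
  P-letter i j = P≡letter-windows m n k l k< l< i j 2≤m 2≤n

  P-injective : ∀ i j i′ j′ → i ≤ k → j ≤ l → i′ ≤ k → j′ ≤ l →
                P m n k l k< l< i j ≈A P m n k l k< l< i′ j′ → i ≡ i′ × j ≡ j′
  P-injective i j i′ j′ i≤k j≤l i′≤k j′≤l same =
    FibRotation.window-injective m 2≤m (F-coprime-pred m) k i i′ i≤k i′≤k k< rows ,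
    FibRotation.window-injective n 2≤n (F-coprime-pred n) l j j′ j≤l j′≤l l< cols
    where
    letters : ∀ r s → letter (fibWindow m i (toℕ r)) (fibWindow n j (toℕ s))
                    ≡ letter (fibWindow m i′ (toℕ r)) (fibWindow n j′ (toℕ s))
    letters r s = trans (sym (P-letter i j i≤k j≤l r s)) (trans (same r s) (P-letter i′ j′ i′≤k j′≤l r s))
    rows : ∀ r → r < k → fibWindow m i r ≡ fibWindow m i′ r
    rows r r<k = subst (λ v → fibWindow m i v ≡ fibWindow m i′ v) (toℕ-fromℕ< r<k)
                       (proj₁ (letter-injective (letters (fromℕ< r<k) (fromℕ< 1≤l))))
    cols : ∀ s → s < l → fibWindow n j s ≡ fibWindow n j′ s
    cols s s<l = subst (λ v → fibWindow n j v ≡ fibWindow n j′ v) (toℕ-fromℕ< s<l)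
                       (proj₂ (letter-injective (letters (fromℕ< 1≤k) (fromℕ< s<l))))

  P-isFactor : ∀ i j → i ≤ k → j ≤ l → IsFactor (P m n k l k< l< i j)
  P-isFactor i j i≤k j≤l = proj₁ rows , proj₁ cols , λ r s →
    trans (P-letter i j i≤k j≤l r s) (cong₂ letter (proj₂ rows (toℕ r) (toℕ<n r)) (proj₂ cols (toℕ s) (toℕ<n s)))
    where
    rows = fibWindow-factor m k i 2≤m k< i≤k
    cols = fibWindow-factor n l j 2≤n l< j≤l

  factor-isP : (u : Array k l) → IsFactor u → ∃[ i ] ∃[ j ] (i ≤ k × j ≤ l × u ≈A P m n k l k< l< i j)
  factor-isP u (p , p′ , u≡) = i , j , i≤k , j≤l , λ r s →
    trans (u≡ r s) (trans (cong₂ letter (row (toℕ r) (toℕ<n r)) (col (toℕ s) (toℕ<n s))) (sym (P-letter i j i≤k j≤l r s)))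
    where
    rows = factor-fibWindow m k p 2≤m k<
    cols = factor-fibWindow n l p′ 2≤n l<
    i = proj₁ rows
    j = proj₁ cols
    i≤k = proj₁ (proj₂ rows)
    j≤l = proj₁ (proj₂ cols)
    row = proj₂ (proj₂ rows)
    col = proj₂ (proj₂ cols)

mainTheorem5 : (m n k l : ℕ) → 1 ≤ k → (k< : k < F m) → 1 ≤ l → (l< : l < F n) →
    ((i j i' j' : ℕ) → i ≤ k → j ≤ l → i' ≤ k → j' ≤ l →
       P m n k l k< l< i j ≈A P m n k l k< l< i' j' → (i ≡ i' × j ≡ j'))
    × ((i j : ℕ) → i ≤ k → j ≤ l → IsFactor (P m n k l k< l< i j))
    × ((u : Array k l) → IsFactor u →
       ∃[ i ] ∃[ j ] (i ≤ k × j ≤ l × u ≈A P m n k l k< l< i j))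
mainTheorem5 m n k l 1≤k k< 1≤l l< = P-injective , P-isFactor , factor-isP
  where open Prefixes m n k l 1≤k k< 1≤l l<
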